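{- For every integer $m\geq 2$ and either choice of $M$, the graph $T_m$ is $2$-extendable.
   Context: For a positive integer $n$, a graph with at least $2n+2$ vertices is $n$-extendable if it has a matching of size $n$ and every matching of size $n$ is contained in a perfect matching. The graph $T_m$ ($m\geq 2$) has vertex set $\{x_{i,j}:1\le i\le 4,\ 1\le j\le m\}$, first subscripts taken modulo $4$, and edges: $x_{i,j}x_{i+1,j}$ for all $1\le i\le 4$, $1\le j\le m$; $x_{1,2j-1}x_{1,2j}$ and $x_{3,2j-1}x_{3,2j}$ for $1\le j\le \lfloor m/2\rfloor$; $x_{2,2j}x_{2,2j+1}$ and $x_{4,2j}x_{4,2j+1}$ for $1\le j\le \lceil m/2\rceil-1$; plus a set $M$ of two edges, where for odd $m$, $M=\{x_{1,m}x_{2,1},x_{3,m}x_{4,1}\}$ or $M=\{x_{1,m}x_{4,1},x_{3,m}x_{2,1}\}$, and for even $m$, $M=\{x_{2,m}x_{2,1},x_{4,m}x_{4,1}\}$ or $M=\{x_{2,m}x_{4,1},x_{4,m}x_{2,1}\}$. -}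

module Defs where

open import Data.Nat using (ℕ; zero; suc; _+_; _*_; _∸_; _≤_; _%_; ⌊_/2⌋; ⌈_/2⌉)
open import Data.Fin using (Fin; toℕ)
open import Data.Fin.Properties using (*↔×)
open import Data.Product using (Σ; ∃; _×_; _,_; proj₁; proj₂)
open import Data.Sum using (_⊎_)
open import Data.List using (List; []; _∷_; length)
open import Data.List.Relation.Unary.All using (All)
open import Data.List.Relation.Unary.Unique.Propositional using (Unique)
open import Data.List.Membership.Propositional using (_∈_)
open import Function.Bundles using (_↔_)
open import Function.Properties.Inverse using (↔-sym)
import Data.Sum
open import Relation.Binary.PropositionalEquality using (_≡_)

record FinGraph : Set₁ where
  field
    V    : Set
    size : ℕ
    enum : V ↔ Fin size
    Adj  : V → V → Set
    Adj-sym : ∀ {u v} → Adj u v → Adj v u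

module _ (G : FinGraph) where
  open FinGraph G

  -- a matching is given as a list of edges (ordered pairs of adjacent vertices)
  endpoints : List (V × V) → List V
  endpoints [] = []
  endpoints ((u , v) ∷ es) = u ∷ v ∷ endpoints es

  IsMatching : List (V × V) → Set
  IsMatching es = All (λ e → Adj (proj₁ e) (proj₂ e)) es × Unique (endpoints es)

  IsPerfectMatching : List (V × V) → Set
  IsPerfectMatching es = IsMatching es × (∀ v → v ∈ endpoints es)

  ContainedIn : List (V × V) → List (V × V) → Set
  ContainedIn es ps = All (λ e → ((proj₁ e , proj₂ e) ∈ ps) ⊎ ((proj₂ e , proj₁ e) ∈ ps)) es

  Extendable : ℕ → Set
  Extendable n =
    (2 * n + 2 ≤ size)
    × (Σ (List (V × V)) λ es → IsMatching es × length es ≡ n)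
    × (∀ es → IsMatching es → length es ≡ n →
         Σ (List (V × V)) λ ps → IsPerfectMatching ps × ContainedIn es ps)

-- The graph T_m.  Coordinates (i , j) are 1-based as in the paper:
-- 1 ≤ i ≤ 4, 1 ≤ j ≤ m.

-- the two choices of the edge set M
data MChoice : Set where
  choice₁ choice₂ : MChoice

-- directed version of the edge set; adjacency is its symmetric closure
data TEdge (m : ℕ) (c : MChoice) : ℕ × ℕ → ℕ × ℕ → Set where
  rung  : ∀ {i j} → 1 ≤ i → i ≤ 3 → 1 ≤ j → j ≤ m → TEdge m c (i , j) (suc i , j)
  rung4 : ∀ {j} → 1 ≤ j → j ≤ m → TEdge m c (4 , j) (1 , j)
  row1  : ∀ {j} → 1 ≤ j → j ≤ ⌊ m /2⌋ → TEdge m c (1 , 2 * j ∸ 1) (1 , 2 * j)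
  row3  : ∀ {j} → 1 ≤ j → j ≤ ⌊ m /2⌋ → TEdge m c (3 , 2 * j ∸ 1) (3 , 2 * j)
  row2  : ∀ {j} → 1 ≤ j → j ≤ ⌈ m /2⌉ ∸ 1 → TEdge m c (2 , 2 * j) (2 , 2 * j + 1)
  row4  : ∀ {j} → 1 ≤ j → j ≤ ⌈ m /2⌉ ∸ 1 → TEdge m c (4 , 2 * j) (4 , 2 * j + 1)
  oddA₁ : m % 2 ≡ 1 → c ≡ choice₁ → TEdge m c (1 , m) (2 , 1)
  oddA₂ : m % 2 ≡ 1 → c ≡ choice₁ → TEdge m c (3 , m) (4 , 1)
  oddB₁ : m % 2 ≡ 1 → c ≡ choice₂ → TEdge m c (1 , m) (4 , 1)
  oddB₂ : m % 2 ≡ 1 → c ≡ choice₂ → TEdge m c (3 , m) (2 , 1)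
  evenA₁ : m % 2 ≡ 0 → c ≡ choice₁ → TEdge m c (2 , m) (2 , 1)
  evenA₂ : m % 2 ≡ 0 → c ≡ choice₁ → TEdge m c (4 , m) (4 , 1)
  evenB₁ : m % 2 ≡ 0 → c ≡ choice₂ → TEdge m c (2 , m) (4 , 1)
  evenB₂ : m % 2 ≡ 0 → c ≡ choice₂ → TEdge m c (4 , m) (2 , 1)

-- vertex x_{i,j} is represented by (i-1 , j-1) : Fin 4 × Fin m
coord : ∀ {m} → Fin 4 × Fin m → ℕ × ℕ
coord (i , j) = suc (toℕ i) , suc (toℕ j)

TAdj : (m : ℕ) → MChoice → Fin 4 × Fin m → Fin 4 × Fin m → Set
TAdj m c u v = TEdge m c (coord u) (coord v) ⊎ TEdge m c (coord v) (coord u)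

T : (m : ℕ) → MChoice → FinGraph
T m c = record
  { V = Fin 4 × Fin m
  ; size = 4 * m
  ; enum = ↔-sym (*↔× {4} {m})
  ; Adj = TAdj m c
  ; Adj-sym = λ { (Data.Sum.inj₁ e) → Data.Sum.inj₂ e ; (Data.Sum.inj₂ e) → Data.Sum.inj₁ e }
  }

-- The horizontal edges of T_m, one at each vertex, form a perfect matching H, and every column
-- is a 4-cycle on which two rows are adjacent exactly when their parities differ. Perfect matchings
-- are handled as fixed-point-free involutions along edges. Two disjoint edges lie in a common
-- perfect matching: in H if both are horizontal; if both are vertical, in a matching that picks one
-- of the two perfect matchings of every column (two disjoint edges of one column are opposite, so
-- they pick the same one); and if one is vertical, in column j, and the other horizontal, in a mixed
-- matching that uses exactly one of the two parallel edges of every link between consecutive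
-- columns and matches the two remaining vertices of each column, which have opposite parities,
-- vertically. The links on either side of column j are chosen to avoid the vertical edge, and the
-- link of the horizontal edge to contain it.
module Submission where

open import Defs
open import Data.Bool using (Bool; true; false; not; _xor_; if_then_else_)
import Data.Bool.Properties as Bool
open import Data.Bool.Properties
  using (not-involutive; ¬-not; not-¬; xor-assoc; xor-comm; xor-same; xor-identityʳ; xor-annihilates-not)
open import Data.Empty using (⊥-elim)
open import Data.Fin as Fin using (Fin; zero; suc; toℕ; fromℕ; inject₁)
open import Data.Fin.Patterns using (0F; 1F; 2F; 3F)
open import Data.Fin.Properties using (toℕ-injective; toℕ-inject₁; toℕ-fromℕ; toℕ<n; <-cmp; <-asym)
open import Data.Fin.Relation.Unary.Top using (View; view; ‵fromℕ; ‵inject₁; view-fromℕ; view-inject₁)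
open import Data.List using (List; []; _∷_; length; map; filter; allFin)
open import Data.List.Membership.Propositional using (_∈_)
open import Data.List.Membership.Propositional.Properties using (∈-map⁺; ∈-filter⁺; ∈-allFin)
import Data.List.Relation.Unary.All as All
open import Data.List.Relation.Unary.All using (All; []; _∷_)
open import Data.List.Relation.Unary.All.Properties using (¬Any⇒All¬; All¬⇒¬Any; all-filter)
open import Data.List.Relation.Unary.Any using (here; there)
open import Data.List.Relation.Unary.AllPairs using ([]; _∷_)
open import Data.List.Relation.Unary.Unique.Propositional using (Unique)
import Data.List.Relation.Unary.Unique.Propositional.Properties as Unique
open import Data.Nat using (ℕ; zero; suc; _+_; _*_; _∸_; _%_; _≤_; z≤n; s≤s; ⌊_/2⌋; ⌈_/2⌉)
import Data.Nat.Properties as ℕ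
open import Data.Nat.Properties
  using (+-suc; +-identityʳ; +-comm; n<1+n; <⇒≢; suc-injective; ∸-monoˡ-≤; ⌊n/2⌋-mono; n≡⌊n+n/2⌋)
open import Data.Product using (Σ-syntax; ∃-syntax; _×_; _,_; proj₁; proj₂)
open import Data.Product.Properties using (,-injectiveˡ; ,-injectiveʳ)
open import Data.Sum using (_⊎_; inj₁; inj₂)
import Data.Sum as Sum
open import Function using (_∘_)
open import Function.Bundles using (Inverse; Injection)
open import Function.Properties.Inverse using (↔⇒↣; ↔-sym)
open import Relation.Binary.Definitions using (tri<; tri≈; tri>)
open import Relation.Binary.PropositionalEquality
open ≡-Reasoning
open import Relation.Nullary using (¬_; Dec; yes; no)
open import Relation.Nullary.Decidable using (toSum)

-- Perfect matchings as involutions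

module _ (G : FinGraph) where
  open FinGraph G
  open Inverse enum using (to; from; strictlyInverseʳ)

  to-injective : ∀ {x y} → to x ≡ to y → x ≡ y
  to-injective = Injection.injective (↔⇒↣ enum)

  from-injective : ∀ {x y} → from x ≡ from y → x ≡ y
  from-injective = Injection.injective (↔⇒↣ (↔-sym enum))

  record MatchingInvolution : Set where
    field
      mate : V → V
      mate-involutive : ∀ v → mate (mate v) ≡ v
      mate-irreflexive : ∀ v → mate v ≢ v
      mate-adjacent : ∀ v → Adj v (mate v)

  module _ (σ : MatchingInvolution) where
    open MatchingInvolution σ

    mate-injective : ∀ {x y} → mate x ≡ mate y → x ≡ y
    mate-injective {x} {y} eq = trans (sym (mate-involutive x)) (trans (cong mate eq) (mate-involutive y))

    Leader : V → Set
    Leader v = to v Fin.< to (mate v)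

    leader-or-mate : ∀ v → Leader v ⊎ Leader (mate v)
    leader-or-mate v with <-cmp (to v) (to (mate v))
    ... | tri< lt _ _ = inj₁ lt
    ... | tri≈ _ eq _ = ⊥-elim (mate-irreflexive v (sym (to-injective eq)))
    ... | tri> _ _ gt = inj₂ (subst (λ w → to (mate v) Fin.< to w) (sym (mate-involutive v)) gt)

    leaders-unmated : ∀ {u v} → Leader u → Leader v → v ≢ mate u
    leaders-unmated {u} {v} lu lv refl =
      <-asym lu (subst (λ w → to (mate u) Fin.< to w) (mate-involutive u) lv)

    pair : V → V × V
    pair v = v , mate v

    ∈-endpoints⁻ : ∀ L {w} → w ∈ endpoints G (map pair L) → ∃[ v ] v ∈ L × (w ≡ v ⊎ w ≡ mate v)
    ∈-endpoints⁻ (v ∷ L) (here refl) = v , here refl , inj₁ refl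
    ∈-endpoints⁻ (v ∷ L) (there (here refl)) = v , here refl , inj₂ refl
    ∈-endpoints⁻ (v ∷ L) (there (there w∈)) with ∈-endpoints⁻ L w∈
    ... | u , u∈ , eq = u , there u∈ , eq

    ∈-endpoints⁺ : ∀ {L v} → v ∈ L → v ∈ endpoints G (map pair L) × mate v ∈ endpoints G (map pair L)
    ∈-endpoints⁺ (here refl) = here refl , there (here refl)
    ∈-endpoints⁺ {_ ∷ _} (there v∈) with ∈-endpoints⁺ v∈
    ... | v∈E , mv∈E = there (there v∈E) , there (there mv∈E)

    endpoints-unique : ∀ {L} → All Leader L → Unique L → Unique (endpoints G (map pair L))
    endpoints-unique {[]} _ _ = []
    endpoints-unique {v ∷ L} (lv ∷ lL) (v∉L ∷ uL) =
      ((mate-irreflexive v ∘ sym) ∷ ¬Any⇒All¬ _ v∉E) ∷ ¬Any⇒All¬ _ mv∉E ∷ endpoints-unique lL uL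
      where
        leader : ∀ {u} → u ∈ L → Leader u
        leader u∈ = All.lookup lL u∈
        v∉E : ¬ v ∈ endpoints G (map pair L)
        v∉E v∈E with ∈-endpoints⁻ L v∈E
        ... | u , u∈ , inj₁ refl = All¬⇒¬Any v∉L u∈
        ... | u , u∈ , inj₂ v≡mu = leaders-unmated (leader u∈) lv v≡mu
        mv∉E : ¬ mate v ∈ endpoints G (map pair L)
        mv∉E mv∈E with ∈-endpoints⁻ L mv∈E
        ... | u , u∈ , inj₁ refl = leaders-unmated lv (leader u∈) refl
        ... | u , u∈ , inj₂ mv≡mu = All¬⇒¬Any v∉L (subst (_∈ L) (sym (mate-injective mv≡mu)) u∈)

    allVertices : List V
    allVertices = map from (allFin size)

    -- Each edge {v , mate v} is listed once, from its endpoint with the smaller index.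
    leaders : List V
    leaders = filter (λ v → to v Fin.<? to (mate v)) allVertices

    ∈-leaders : ∀ {v} → Leader v → v ∈ leaders
    ∈-leaders {v} lv = ∈-filter⁺ (λ v → to v Fin.<? to (mate v))
      (subst (_∈ allVertices) (strictlyInverseʳ v) (∈-map⁺ from (∈-allFin (to v)))) lv

    perfectMatchingOf : List (V × V)
    perfectMatchingOf = map pair leaders

    perfectMatchingOf-isPerfect : IsPerfectMatching G perfectMatchingOf
    perfectMatchingOf-isPerfect = (adjacent leaders , unique) , covers
      where
        adjacent : ∀ L → All (λ e → Adj (proj₁ e) (proj₂ e)) (map pair L)
        adjacent [] = []
        adjacent (v ∷ L) = mate-adjacent v ∷ adjacent L
        unique : Unique (endpoints G perfectMatchingOf)
        unique = endpoints-unique (all-filter _ allVertices)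
          (Unique.filter⁺ _ (Unique.map⁺ from-injective (Unique.allFin⁺ size)))
        covers : ∀ v → v ∈ endpoints G perfectMatchingOf
        covers v with leader-or-mate v
        ... | inj₁ lv = proj₁ (∈-endpoints⁺ (∈-leaders lv))
        ... | inj₂ lmv = subst (_∈ endpoints G perfectMatchingOf) (mate-involutive v)
                           (proj₂ (∈-endpoints⁺ (∈-leaders lmv)))

    perfectMatchingOf-contains : ∀ {v w} → mate v ≡ w →
      (v , w) ∈ perfectMatchingOf ⊎ (w , v) ∈ perfectMatchingOf
    perfectMatchingOf-contains {v} refl with leader-or-mate v
    ... | inj₁ lv = inj₁ (∈-map⁺ pair (∈-leaders lv))
    ... | inj₂ lmv = inj₂ (subst (λ u → (mate v , u) ∈ perfectMatchingOf) (mate-involutive v)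
                             (∈-map⁺ pair (∈-leaders lmv)))

open MatchingInvolution using (mate; mate-involutive)

-- Parity and halving

even : ℕ → Bool
even zero = true
even (suc n) = not (even n)

%2≡if-even : ∀ n → n % 2 ≡ (if even n then 0 else 1)
%2≡if-even zero = refl
%2≡if-even (suc zero) = refl
%2≡if-even (suc (suc n)) = trans (%2≡if-even n) (cong (if_then 0 else 1) (sym (not-involutive (even n))))

even-double : ∀ k → even (k + k) ≡ true
even-double zero = refl
even-double (suc k) rewrite +-suc k k | even-double k = refl

mutual
  even⇒double : ∀ n → even n ≡ true → ∃[ k ] n ≡ k + k
  even⇒double zero _ = zero , refl
  even⇒double (suc n) e with odd⇒double+1 n (trans (sym (not-involutive (even n))) (cong not e))
  ... | k , refl = suc k , cong suc (sym (+-suc k k))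

  odd⇒double+1 : ∀ n → even n ≡ false → ∃[ k ] n ≡ suc (k + k)
  odd⇒double+1 zero ()
  odd⇒double+1 (suc n) e with even⇒double n (trans (sym (not-involutive (even n))) (cong not e))
  ... | k , refl = k , refl

even⇒%2≡0 : ∀ {n} → even n ≡ true → n % 2 ≡ 0
even⇒%2≡0 {n} e = trans (%2≡if-even n) (cong (if_then 0 else 1) e)

odd⇒%2≡1 : ∀ {n} → even n ≡ false → n % 2 ≡ 1
odd⇒%2≡1 {n} e = trans (%2≡if-even n) (cong (if_then 0 else 1) e)

%2≡0⇒even : ∀ {n} → n % 2 ≡ 0 → even n ≡ true
%2≡0⇒even {n} h with even n | %2≡if-even n
... | true | _ = refl
... | false | e with () ← trans (sym h) e

%2≡1⇒odd : ∀ {n} → n % 2 ≡ 1 → even n ≡ false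
%2≡1⇒odd {n} h with even n | %2≡if-even n
... | false | _ = refl
... | true | e with () ← trans (sym h) e

2*[1+k]≡2+k+k : ∀ k → 2 * suc k ≡ suc (suc (k + k))
2*[1+k]≡2+k+k k = cong suc (trans (cong (λ x → k + suc x) (+-identityʳ k)) (+-suc k k))

2*[1+k]∸1≡1+k+k : ∀ k → 2 * suc k ∸ 1 ≡ suc (k + k)
2*[1+k]∸1≡1+k+k k = cong (_∸ 1) (2*[1+k]≡2+k+k k)

2*[1+k]+1≡3+k+k : ∀ k → 2 * suc k + 1 ≡ suc (suc (suc (k + k)))
2*[1+k]+1≡3+k+k k = trans (+-comm (2 * suc k) 1) (cong suc (2*[1+k]≡2+k+k k))

2+k+k≤m⇒1+k≤⌊m/2⌋ : ∀ {k m} → suc (suc (k + k)) ≤ m → suc k ≤ ⌊ m /2⌋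
2+k+k≤m⇒1+k≤⌊m/2⌋ {k} {m} le =
  subst (_≤ ⌊ m /2⌋) (cong suc (sym (n≡⌊n+n/2⌋ k))) (⌊n/2⌋-mono le)

3+k+k≤m⇒1+k≤⌈m/2⌉∸1 : ∀ {k m} → suc (suc (suc (k + k))) ≤ m → suc k ≤ ⌈ m /2⌉ ∸ 1
3+k+k≤m⇒1+k≤⌈m/2⌉∸1 {k} {m} le =
  ∸-monoˡ-≤ 1 (2+k+k≤m⇒1+k≤⌊m/2⌋ {suc k}
    (subst (λ x → suc (suc (suc x)) ≤ suc m) (sym (+-suc k k)) (s≤s le)))

xor-cancelʳ : ∀ x y → (x xor y) xor y ≡ x
xor-cancelʳ x y = trans (xor-assoc x y y) (trans (cong (x xor_) (xor-same y)) (xor-identityʳ x))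

-- Rows, columns and the edges of T_m

-- Row i of T_m (0-based) is coded by its parity and its level (whether i ≥ 2); two rows are
-- adjacent on the 4-cycle x_{1,j} x_{2,j} x_{3,j} x_{4,j} exactly when their parities differ.
parity : Fin 4 → Bool
parity i = even (toℕ i)

level : Fin 4 → Bool
level 0F = false
level 1F = false
level 2F = true
level 3F = true

row : Bool → Bool → Fin 4
row true false = 0F
row false false = 1F
row true true = 2F
row false true = 3F

row-parity-level : ∀ i → row (parity i) (level i) ≡ i
row-parity-level 0F = refl
row-parity-level 1F = refl
row-parity-level 2F = refl
row-parity-level 3F = refl

parity-row : ∀ p b → parity (row p b) ≡ p
parity-row true false = refl
parity-row false false = refl
parity-row true true = refl
parity-row false true = refl

level-row : ∀ p b → level (row p b) ≡ b
level-row true false = refl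
level-row false false = refl
level-row true true = refl
level-row false true = refl

level-opposite : ∀ {i i′} → parity i ≡ parity i′ → i ≢ i′ → level i ≡ not (level i′)
level-opposite {i} {i′} p i≢i′ = ¬-not λ l → i≢i′
  (trans (sym (row-parity-level i)) (trans (cong₂ row p l) (row-parity-level i′)))

row-xor-twice : ∀ p q b t → row p (level (row q (b xor t)) xor t) ≡ row p b
row-xor-twice p q b t = cong (row p) (trans (cong (_xor t) (level-row q (b xor t))) (xor-cancelʳ b t))

prev : ∀ {k} → Fin (suc k) → Fin (suc k)
prev {k} zero = fromℕ k
prev (suc j) = inject₁ j

prev-irreflexive : ∀ {k} (j : Fin (suc (suc k))) → prev j ≢ j
prev-irreflexive zero ()
prev-irreflexive (suc j) eq = <⇒≢ (n<1+n (toℕ j)) (trans (sym (toℕ-inject₁ j)) (cong toℕ eq))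

twist : MChoice → Bool
twist choice₁ = false
twist choice₂ = true

vertical-adjacent : ∀ {m c} i i′ (j : Fin m) → parity i′ ≡ not (parity i) → TAdj m c (i , j) (i′ , j)
vertical-adjacent 0F 1F j _ = inj₁ (rung (s≤s z≤n) (s≤s z≤n) (s≤s z≤n) (toℕ<n j))
vertical-adjacent 1F 2F j _ = inj₁ (rung (s≤s z≤n) (s≤s (s≤s z≤n)) (s≤s z≤n) (toℕ<n j))
vertical-adjacent 2F 3F j _ = inj₁ (rung (s≤s z≤n) (s≤s (s≤s (s≤s z≤n))) (s≤s z≤n) (toℕ<n j))
vertical-adjacent 3F 0F j _ = inj₁ (rung4 (s≤s z≤n) (toℕ<n j))
vertical-adjacent 1F 0F j _ = inj₂ (rung (s≤s z≤n) (s≤s z≤n) (s≤s z≤n) (toℕ<n j))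
vertical-adjacent 2F 1F j _ = inj₂ (rung (s≤s z≤n) (s≤s (s≤s z≤n)) (s≤s z≤n) (toℕ<n j))
vertical-adjacent 3F 2F j _ = inj₂ (rung (s≤s z≤n) (s≤s (s≤s (s≤s z≤n))) (s≤s z≤n) (toℕ<n j))
vertical-adjacent 0F 3F j _ = inj₂ (rung4 (s≤s z≤n) (toℕ<n j))
vertical-adjacent 0F 0F j ()
vertical-adjacent 0F 2F j ()
vertical-adjacent 1F 1F j ()
vertical-adjacent 1F 3F j ()
vertical-adjacent 2F 0F j ()
vertical-adjacent 2F 2F j ()
vertical-adjacent 3F 1F j ()
vertical-adjacent 3F 3F j ()

-- M joins the last column to the odd rows of the first one, keeping the level of the row for the
-- first choice of M and exchanging it for the second.
wrapRow : MChoice → Fin 4 → Fin 4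
wrapRow c i = row false (level i xor twist c)

wrap-edge : ∀ n c i → parity i ≡ even (suc n) →
  TEdge (suc (suc n)) c (suc (toℕ i) , suc (suc n)) (suc (toℕ (wrapRow c i)) , 1)
wrap-edge n choice₁ 0F e = oddA₁ (odd⇒%2≡1 {suc (suc n)} (cong not (sym e))) refl
wrap-edge n choice₁ 1F e = evenA₁ (even⇒%2≡0 {suc (suc n)} (cong not (sym e))) refl
wrap-edge n choice₁ 2F e = oddA₂ (odd⇒%2≡1 {suc (suc n)} (cong not (sym e))) refl
wrap-edge n choice₁ 3F e = evenA₂ (even⇒%2≡0 {suc (suc n)} (cong not (sym e))) refl
wrap-edge n choice₂ 0F e = oddB₁ (odd⇒%2≡1 {suc (suc n)} (cong not (sym e))) refl
wrap-edge n choice₂ 1F e = evenB₁ (even⇒%2≡0 {suc (suc n)} (cong not (sym e))) refl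
wrap-edge n choice₂ 2F e = oddB₂ (odd⇒%2≡1 {suc (suc n)} (cong not (sym e))) refl
wrap-edge n choice₂ 3F e = evenB₂ (even⇒%2≡0 {suc (suc n)} (cong not (sym e))) refl

inner-edge : ∀ {m c} i J → parity i ≡ even J → suc (suc J) ≤ m →
  TEdge m c (suc (toℕ i) , suc J) (suc (toℕ i) , suc (suc J))
inner-edge {m} {c} 0F J e le with even⇒double J (sym e)
... | k , refl = subst₂ (λ a b → TEdge m c (1 , a) (1 , b)) (2*[1+k]∸1≡1+k+k k) (2*[1+k]≡2+k+k k)
                        (row1 (s≤s z≤n) (2+k+k≤m⇒1+k≤⌊m/2⌋ le))
inner-edge {m} {c} 2F J e le with even⇒double J (sym e)
... | k , refl = subst₂ (λ a b → TEdge m c (3 , a) (3 , b)) (2*[1+k]∸1≡1+k+k k) (2*[1+k]≡2+k+k k)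
                        (row3 (s≤s z≤n) (2+k+k≤m⇒1+k≤⌊m/2⌋ le))
inner-edge {m} {c} 1F J e le with odd⇒double+1 J (sym e)
... | k , refl = subst₂ (λ a b → TEdge m c (2 , a) (2 , b)) (2*[1+k]≡2+k+k k) (2*[1+k]+1≡3+k+k k)
                        (row2 (s≤s z≤n) (3+k+k≤m⇒1+k≤⌈m/2⌉∸1 le))
inner-edge {m} {c} 3F J e le with odd⇒double+1 J (sym e)
... | k , refl = subst₂ (λ a b → TEdge m c (4 , a) (4 , b)) (2*[1+k]≡2+k+k k) (2*[1+k]+1≡3+k+k k)
                        (row4 (s≤s z≤n) (3+k+k≤m⇒1+k≤⌈m/2⌉∸1 le))

-- The graph T_m for m = n + 2

module Layout (n : ℕ) (c : MChoice) where

  m : ℕ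
  m = suc (suc n)

  Vertex : Set
  Vertex = Fin 4 × Fin m

  last : Fin m
  last = fromℕ (suc n)

  unwrapRow : Fin 4 → Fin 4
  unwrapRow i = row (even (suc n)) (level i xor twist c)

  right-from : Fin 4 → {j : Fin m} → View j → Vertex
  right-from i ‵fromℕ = wrapRow c i , zero
  right-from i (‵inject₁ j) = i , suc j

  right : Vertex → Vertex
  right (i , j) = right-from i (view j)

  left : Vertex → Vertex
  left (i , zero) = unwrapRow i , last
  left (i , suc j) = i , inject₁ j

  -- The horizontal edge at a vertex leads to the next column exactly when row and column have
  -- the same parity.
  Rightward : Vertex → Set
  Rightward v = parity (proj₁ v) ≡ even (toℕ (proj₂ v))

  rightward? : ∀ v → Dec (Rightward v)
  rightward? (i , j) = parity i Bool.≟ even (toℕ j)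

  horizontal : Vertex → Vertex
  horizontal v with rightward? v
  ... | yes _ = right v
  ... | no _ = left v

  right-last : ∀ i → right (i , last) ≡ (wrapRow c i , zero)
  right-last i = cong (right-from i) (view-fromℕ (suc n))

  right-inject₁ : ∀ i j → right (i , inject₁ j) ≡ (i , suc j)
  right-inject₁ i j = cong (right-from i) (view-inject₁ j)

  right-inner : ∀ {i j j′} → toℕ j′ ≡ suc (toℕ j) → right (i , j) ≡ (i , j′)
  right-inner {i} {j} {j′} eq with view j
  ... | ‵fromℕ = ⊥-elim (ℕ.<-irrefl (trans eq (cong suc (toℕ-fromℕ (suc n)))) (toℕ<n j′))
  ... | ‵inject₁ j″ = cong (i ,_) (toℕ-injective (trans (cong suc (sym (toℕ-inject₁ j″))) (sym eq)))

  unwrap-wrap : ∀ i → parity i ≡ even (suc n) → unwrapRow (wrapRow c i) ≡ i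
  unwrap-wrap i p = begin
    row (even (suc n)) (level (row false (level i xor twist c)) xor twist c)
      ≡⟨ row-xor-twice (even (suc n)) false (level i) (twist c) ⟩
    row (even (suc n)) (level i)
      ≡⟨ cong (λ q → row q (level i)) (sym p) ⟩
    row (parity i) (level i)
      ≡⟨ row-parity-level i ⟩
    i ∎

  wrap-unwrap : ∀ i → parity i ≡ false → wrapRow c (unwrapRow i) ≡ i
  wrap-unwrap i p = begin
    row false (level (row (even (suc n)) (level i xor twist c)) xor twist c)
      ≡⟨ row-xor-twice false (even (suc n)) (level i) (twist c) ⟩
    row false (level i)
      ≡⟨ cong (λ q → row q (level i)) (sym p) ⟩
    row (parity i) (level i)
      ≡⟨ row-parity-level i ⟩
    i ∎

  left-right : ∀ v → Rightward v → left (right v) ≡ v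
  left-right (i , j) r with view j
  ... | ‵fromℕ = cong (_, last) (unwrap-wrap i (trans r (cong even (toℕ-fromℕ (suc n)))))
  ... | ‵inject₁ j′ = refl

  right-left : ∀ v → ¬ Rightward v → right (left v) ≡ v
  right-left (i , zero) ¬r = trans (right-last (unwrapRow i)) (cong (_, zero) (wrap-unwrap i (¬-not ¬r)))
  right-left (i , suc j) _ = right-inject₁ i j

  right-leftward : ∀ v → Rightward v → ¬ Rightward (right v)
  right-leftward (i , j) r with view j
  ... | ‵fromℕ = not-¬ (parity-row false (level i xor twist c))
  ... | ‵inject₁ j′ = not-¬ (trans r (cong even (toℕ-inject₁ j′)))

  left-rightward : ∀ v → ¬ Rightward v → Rightward (left v)
  left-rightward (i , zero) _ =
    trans (parity-row (even (suc n)) (level i xor twist c)) (cong even (sym (toℕ-fromℕ (suc n))))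
  left-rightward (i , suc j) ¬r =
    trans (trans (¬-not ¬r) (not-involutive _)) (cong even (sym (toℕ-inject₁ j)))

  col-left : ∀ i j → proj₂ (left (i , j)) ≡ prev j
  col-left i zero = refl
  col-left i (suc j) = refl

  col-right-prev : ∀ i j → proj₂ (right (i , prev j)) ≡ j
  col-right-prev i zero = cong proj₂ (right-last i)
  col-right-prev i (suc j) = cong proj₂ (right-inject₁ i j)

  horizontal-rightward : ∀ v → Rightward v → horizontal v ≡ right v
  horizontal-rightward v r with rightward? v
  ... | yes _ = refl
  ... | no ¬r = ⊥-elim (¬r r)

  horizontal-leftward : ∀ v → ¬ Rightward v → horizontal v ≡ left v
  horizontal-leftward v ¬r with rightward? v
  ... | yes r = ⊥-elim (¬r r)
  ... | no _ = refl

  horizontal-involutive : ∀ v → horizontal (horizontal v) ≡ v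
  horizontal-involutive v with rightward? v
  ... | yes r = trans (horizontal-leftward (right v) (right-leftward v r)) (left-right v r)
  ... | no ¬r = trans (horizontal-rightward (left v) (left-rightward v ¬r)) (right-left v ¬r)

  horizontal-irreflexive : ∀ v → horizontal v ≢ v
  horizontal-irreflexive v with rightward? v
  ... | yes r = λ eq → right-leftward v r (subst Rightward (sym eq) r)
  ... | no ¬r = λ eq → ¬r (subst Rightward eq (left-rightward v ¬r))

  right-adjacent : ∀ v → Rightward v → TAdj m c v (right v)
  right-adjacent (i , j) r with view j
  ... | ‵fromℕ = inj₁ (subst (λ x → TEdge m c (suc (toℕ i) , suc x) (suc (toℕ (wrapRow c i)) , 1))
                         (sym (toℕ-fromℕ (suc n)))
                         (wrap-edge n c i (trans r (cong even (toℕ-fromℕ (suc n))))))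
  ... | ‵inject₁ j′ = inj₁ (subst (λ x → TEdge m c (suc (toℕ i) , suc x) (suc (toℕ i) , suc (suc (toℕ j′))))
                         (sym (toℕ-inject₁ j′))
                         (inner-edge i (toℕ j′) (trans r (cong even (toℕ-inject₁ j′)))
                           (s≤s (toℕ<n j′))))

  horizontal-adjacent : ∀ v → TAdj m c v (horizontal v)
  horizontal-adjacent v with rightward? v
  ... | yes r = right-adjacent v r
  ... | no ¬r = Sum.swap (subst (TAdj m c (left v)) (right-left v ¬r)
                                (right-adjacent (left v) (left-rightward v ¬r)))

  Vertical : Vertex → Vertex → Set
  Vertical u v = proj₂ v ≡ proj₂ u × parity (proj₁ v) ≡ not (parity (proj₁ u))

  vertical-sym : ∀ u v → Vertical u v → Vertical v u
  vertical-sym (i , j) (i′ , j′) (refl , p) = refl , trans (sym (not-involutive (parity i))) (cong not (sym p))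

  last-even : m % 2 ≡ 1 → even (suc n) ≡ true
  last-even odd = trans (sym (not-involutive _)) (cong not (%2≡1⇒odd {m} odd))

  last-odd : m % 2 ≡ 0 → even (suc n) ≡ false
  last-odd ev = trans (sym (not-involutive _)) (cong not (%2≡0⇒even {m} ev))

  inner-edge⇒right : ∀ {u v} i J → coord u ≡ (suc (toℕ i) , suc J) →
    coord v ≡ (suc (toℕ i) , suc (suc J)) → parity i ≡ even J → Rightward u × v ≡ right u
  inner-edge⇒right {iu , ju} {iv , jv} i J p q e =
    rightward , sym (trans (right-inner jv-next) (cong (_, jv) (trans iu≡i (sym iv≡i))))
    where
      iu≡i : iu ≡ i
      iu≡i = toℕ-injective (suc-injective (,-injectiveˡ p))
      iv≡i : iv ≡ i
      iv≡i = toℕ-injective (suc-injective (,-injectiveˡ q))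
      ju≡J : toℕ ju ≡ J
      ju≡J = suc-injective (,-injectiveʳ p)
      jv-next : toℕ jv ≡ suc (toℕ ju)
      jv-next = trans (suc-injective (,-injectiveʳ q)) (cong suc (sym ju≡J))
      rightward : Rightward (iu , ju)
      rightward = trans (cong parity iu≡i) (trans e (cong even (sym ju≡J)))

  wrap-edge⇒right : ∀ {u v c′} i → c ≡ c′ → (suc (toℕ i) , m) ≡ coord u →
    (suc (toℕ (wrapRow c′ i)) , 1) ≡ coord v → parity i ≡ even (suc n) → Rightward u × v ≡ right u
  wrap-edge⇒right {iu , ju} {iv , jv} i refl p q e = rightward , sym (begin
      right (iu , ju)      ≡⟨ cong right (cong₂ _,_ iu≡i ju≡last) ⟩
      right (i , last)     ≡⟨ right-last i ⟩
      (wrapRow c i , zero) ≡⟨ cong₂ _,_ (sym iv≡wrap) (sym jv≡zero) ⟩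
      (iv , jv)            ∎)
    where
      iu≡i : iu ≡ i
      iu≡i = toℕ-injective (suc-injective (sym (,-injectiveˡ p)))
      iv≡wrap : iv ≡ wrapRow c i
      iv≡wrap = toℕ-injective (suc-injective (sym (,-injectiveˡ q)))
      ju≡last : ju ≡ last
      ju≡last = toℕ-injective (trans (suc-injective (sym (,-injectiveʳ p))) (sym (toℕ-fromℕ (suc n))))
      jv≡zero : jv ≡ zero
      jv≡zero = toℕ-injective {i = jv} {j = zero} (suc-injective (sym (,-injectiveʳ q)))
      rightward : Rightward (iu , ju)
      rightward = trans (cong parity iu≡i) (trans e (cong even (suc-injective (,-injectiveʳ p))))

  tedge-cases : ∀ {p q} → TEdge m c p q → ∀ {u v} → p ≡ coord u → q ≡ coord v →
    Vertical u v ⊎ (Rightward u × v ≡ right u)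
  tedge-cases (rung _ _ _ _) {i , j} {i′ , j′} p q = inj₁
    ( toℕ-injective (suc-injective (trans (sym (,-injectiveʳ q)) (,-injectiveʳ p)))
    , cong even (suc-injective (trans (sym (,-injectiveˡ q)) (cong suc (,-injectiveˡ p)))) )
  tedge-cases (rung4 _ _) {i , j} {i′ , j′} p q = inj₁
    ( toℕ-injective (suc-injective (trans (sym (,-injectiveʳ q)) (,-injectiveʳ p)))
    , trans (cong even (sym (suc-injective (,-injectiveˡ q))))
            (cong (not ∘ even) (suc-injective (,-injectiveˡ p))) )
  tedge-cases (row1 {suc k} _ _) p q = inj₂ (inner-edge⇒right 0F (k + k)
    (trans (sym p) (cong (1 ,_) (2*[1+k]∸1≡1+k+k k))) (trans (sym q) (cong (1 ,_) (2*[1+k]≡2+k+k k)))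
    (sym (even-double k)))
  tedge-cases (row3 {suc k} _ _) p q = inj₂ (inner-edge⇒right 2F (k + k)
    (trans (sym p) (cong (3 ,_) (2*[1+k]∸1≡1+k+k k))) (trans (sym q) (cong (3 ,_) (2*[1+k]≡2+k+k k)))
    (sym (even-double k)))
  tedge-cases (row2 {suc k} _ _) p q = inj₂ (inner-edge⇒right 1F (suc (k + k))
    (trans (sym p) (cong (2 ,_) (2*[1+k]≡2+k+k k)))
    (trans (sym q) (cong (2 ,_) (2*[1+k]+1≡3+k+k k)))
    (cong not (sym (even-double k))))
  tedge-cases (row4 {suc k} _ _) p q = inj₂ (inner-edge⇒right 3F (suc (k + k))
    (trans (sym p) (cong (4 ,_) (2*[1+k]≡2+k+k k)))
    (trans (sym q) (cong (4 ,_) (2*[1+k]+1≡3+k+k k)))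
    (cong not (sym (even-double k))))
  tedge-cases (oddA₁ odd e) p q = inj₂ (wrap-edge⇒right 0F e p q (sym (last-even odd)))
  tedge-cases (oddA₂ odd e) p q = inj₂ (wrap-edge⇒right 2F e p q (sym (last-even odd)))
  tedge-cases (oddB₁ odd e) p q = inj₂ (wrap-edge⇒right 0F e p q (sym (last-even odd)))
  tedge-cases (oddB₂ odd e) p q = inj₂ (wrap-edge⇒right 2F e p q (sym (last-even odd)))
  tedge-cases (evenA₁ ev e) p q = inj₂ (wrap-edge⇒right 1F e p q (sym (last-odd ev)))
  tedge-cases (evenA₂ ev e) p q = inj₂ (wrap-edge⇒right 3F e p q (sym (last-odd ev)))
  tedge-cases (evenB₁ ev e) p q = inj₂ (wrap-edge⇒right 1F e p q (sym (last-odd ev)))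
  tedge-cases (evenB₂ ev e) p q = inj₂ (wrap-edge⇒right 3F e p q (sym (last-odd ev)))

  adjacent-cases : ∀ u v → TAdj m c u v → Vertical u v ⊎ v ≡ horizontal u
  adjacent-cases u v (inj₁ e) with tedge-cases e refl refl
  ... | inj₁ vertical = inj₁ vertical
  ... | inj₂ (r , v≡) = inj₂ (trans v≡ (sym (horizontal-rightward u r)))
  adjacent-cases u v (inj₂ e) with tedge-cases e refl refl
  ... | inj₁ vertical = inj₁ (vertical-sym v u vertical)
  ... | inj₂ (r , u≡) = inj₂ (begin
      v                         ≡⟨ sym (horizontal-involutive v) ⟩
      horizontal (horizontal v) ≡⟨ cong horizontal (trans (horizontal-rightward v r) (sym u≡)) ⟩
      horizontal u              ∎)

  vertical⇒adjacent : ∀ u v → Vertical u v → TAdj m c u v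
  vertical⇒adjacent (i , j) (i′ , .j) (refl , p) = vertical-adjacent i i′ j p

  vertical-irreflexive : ∀ u v → Vertical u v → v ≢ u
  vertical-irreflexive (i , j) _ (_ , p) refl = not-¬ refl p

  vertical-rightward : ∀ u v → Vertical u v → ¬ Rightward u → Rightward v
  vertical-rightward (i , j) (i′ , .j) (refl , p) ¬r = trans p (trans (cong not (¬-not ¬r)) (not-involutive _))

  vertical-leftward : ∀ u v → Vertical u v → Rightward u → ¬ Rightward v
  vertical-leftward (i , j) (i′ , .j) (refl , p) r r′ = not-¬ refl (trans (sym r′) (trans p (cong not r)))

  horizontalMatching : MatchingInvolution (T m c)
  horizontalMatching = record
    { mate = horizontal
    ; mate-involutive = horizontal-involutive
    ; mate-irreflexive = horizontal-irreflexive
    ; mate-adjacent = horizontal-adjacent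
    }

  verticalMate : (Fin m → Bool) → Vertex → Vertex
  verticalMate s (i , j) = row (not (parity i)) (level i xor s j) , j

  verticalMate-vertical : ∀ s v → Vertical v (verticalMate s v)
  verticalMate-vertical s (i , j) = refl , parity-row (not (parity i)) (level i xor s j)

  verticalMate-involutive : ∀ s v → verticalMate s (verticalMate s v) ≡ v
  verticalMate-involutive s (i , j) = cong (_, j) (begin
    row (not (parity (row p b))) (level (row p b) xor s j)
      ≡⟨ cong₂ row (cong not (parity-row p b)) (cong (_xor s j) (level-row p b)) ⟩
    row (not (not (parity i))) ((level i xor s j) xor s j)
      ≡⟨ cong₂ row (not-involutive (parity i)) (xor-cancelʳ (level i) (s j)) ⟩
    row (parity i) (level i)
      ≡⟨ row-parity-level i ⟩
    i ∎)
    where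
      p : Bool
      p = not (parity i)
      b : Bool
      b = level i xor s j

  verticalMatching : (Fin m → Bool) → MatchingInvolution (T m c)
  verticalMatching s = record
    { mate = verticalMate s
    ; mate-involutive = verticalMate-involutive s
    ; mate-irreflexive = λ v → vertical-irreflexive v (verticalMate s v) (verticalMate-vertical s v)
    ; mate-adjacent = λ v → vertical⇒adjacent v (verticalMate s v) (verticalMate-vertical s v)
    }

  rightEnd : Vertex → Vertex
  rightEnd v with rightward? v
  ... | yes _ = v
  ... | no _ = left v

  rightEnd-rightward : ∀ v → Rightward v → rightEnd v ≡ v
  rightEnd-rightward v r with rightward? v
  ... | yes _ = refl
  ... | no ¬r = ⊥-elim (¬r r)

  rightEnd-leftward : ∀ v → ¬ Rightward v → rightEnd v ≡ left v
  rightEnd-leftward v ¬r with rightward? v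
  ... | yes r = ⊥-elim (¬r r)
  ... | no _ = refl

  rightward-rightEnd : ∀ v → Rightward (rightEnd v)
  rightward-rightEnd v with rightward? v
  ... | yes r = r
  ... | no ¬r = left-rightward v ¬r

  rightEnd-horizontal : ∀ v → rightEnd (horizontal v) ≡ rightEnd v
  rightEnd-horizontal v with rightward? v
  ... | yes r = trans (rightEnd-leftward (right v) (right-leftward v r)) (left-right v r)
  ... | no ¬r = rightEnd-rightward (left v) (left-rightward v ¬r)

  rightEnd-cases : ∀ v → (rightEnd v ≡ v × right (rightEnd v) ≡ horizontal v)
                       ⊎ (rightEnd v ≡ horizontal v × right (rightEnd v) ≡ v)
  rightEnd-cases v with rightward? v
  ... | yes _ = inj₁ (refl , refl)
  ... | no ¬r = inj₂ (refl , right-left v ¬r)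

  rightward-level-opposite : ∀ u v → proj₂ u ≡ proj₂ v → Rightward u → Rightward v → u ≢ v →
    level (proj₁ u) ≡ not (level (proj₁ v))
  rightward-level-opposite (i , j) (i′ , .j) refl r r′ u≢v =
    level-opposite (trans r (sym r′)) (λ i≡i′ → u≢v (cong (_, j) i≡i′))

  -- On the link from column j to the next one, the mixed matching uses the edge whose rightward
  -- end has level g j.
  module Mixed (g : Fin m → Bool) where

    Chosen : Vertex → Set
    Chosen v = level (proj₁ v) ≡ g (proj₂ v)

    Horizontal : Vertex → Set
    Horizontal v = Chosen (rightEnd v)

    horizontal? : ∀ v → Dec (Horizontal v)
    horizontal? v = level (proj₁ (rightEnd v)) Bool.≟ g (proj₂ (rightEnd v))

    horizontal-preserves-Horizontal : ∀ v → Horizontal v → Horizontal (horizontal v)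
    horizontal-preserves-Horizontal v = subst Chosen (sym (rightEnd-horizontal v))

    -- The two vertices of column j that the chosen horizontal edges leave uncovered.
    freeRight : Fin m → Vertex
    freeRight j = row (even (toℕ j)) (not (g j)) , j

    freeLeft : Fin m → Vertex
    freeLeft j = right (freeRight (prev j))

    freeMate : Vertex → Vertex
    freeMate v with rightward? v
    ... | yes _ = freeLeft (proj₂ v)
    ... | no _ = freeRight (proj₂ v)

    mixedMate : Vertex → Vertex
    mixedMate v with horizontal? v
    ... | yes _ = horizontal v
    ... | no _ = freeMate v

    freeRight-rightward : ∀ j → Rightward (freeRight j)
    freeRight-rightward j = parity-row (even (toℕ j)) (not (g j))

    freeLeft-leftward : ∀ j → ¬ Rightward (freeLeft j)
    freeLeft-leftward j = right-leftward (freeRight (prev j)) (freeRight-rightward (prev j))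

    col-freeLeft : ∀ j → proj₂ (freeLeft j) ≡ j
    col-freeLeft j = col-right-prev (proj₁ (freeRight (prev j))) j

    freeRight-free : ∀ j → ¬ Horizontal (freeRight j)
    freeRight-free j h = not-¬ refl (sym (trans (sym (level-row (even (toℕ j)) (not (g j)))) chosen))
      where
        chosen : Chosen (freeRight j)
        chosen = subst Chosen (rightEnd-rightward (freeRight j) (freeRight-rightward j)) h

    freeLeft-free : ∀ j → ¬ Horizontal (freeLeft j)
    freeLeft-free j h = freeRight-free (prev j) (subst Chosen (rightEnd-horizontal x)
      (subst Horizontal (sym (horizontal-rightward x (freeRight-rightward (prev j)))) h))
      where
        x : Vertex
        x = freeRight (prev j)

    free-rightward : ∀ v → ¬ Horizontal v → Rightward v → v ≡ freeRight (proj₂ v)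
    free-rightward (i , j) ¬h r =
      cong (_, j) (trans (sym (row-parity-level i)) (cong₂ row r (¬-not unchosen)))
      where
        unchosen : ¬ Chosen (i , j)
        unchosen = ¬h ∘ subst Chosen (sym (rightEnd-rightward (i , j) r))

    free-leftward : ∀ v → ¬ Horizontal v → ¬ Rightward v → v ≡ freeLeft (proj₂ v)
    free-leftward (i , j) ¬h ¬r = begin
      (i , j)
        ≡⟨ sym (right-left (i , j) ¬r) ⟩
      right (left (i , j))
        ≡⟨ cong right (free-rightward (left (i , j)) ¬h′ (left-rightward (i , j) ¬r)) ⟩
      right (freeRight (proj₂ (left (i , j))))
        ≡⟨ cong (right ∘ freeRight) (col-left i j) ⟩
      freeLeft j ∎
      where
        ¬h′ : ¬ Horizontal (left (i , j))
        ¬h′ = ¬h ∘ subst Chosen (sym (rightEnd-leftward (i , j) ¬r))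
                 ∘ subst Chosen (rightEnd-rightward (left (i , j)) (left-rightward (i , j) ¬r))

    freeMate-rightward : ∀ v → Rightward v → freeMate v ≡ freeLeft (proj₂ v)
    freeMate-rightward v r with rightward? v
    ... | yes _ = refl
    ... | no ¬r = ⊥-elim (¬r r)

    freeMate-leftward : ∀ v → ¬ Rightward v → freeMate v ≡ freeRight (proj₂ v)
    freeMate-leftward v ¬r with rightward? v
    ... | yes r = ⊥-elim (¬r r)
    ... | no _ = refl

    freeMate-vertical : ∀ v → Vertical v (freeMate v)
    freeMate-vertical (i , j) with rightward? (i , j)
    ... | yes r = col-freeLeft j ,
          trans (¬-not (freeLeft-leftward j))
                (trans (cong (not ∘ even ∘ toℕ) (col-freeLeft j)) (cong not (sym r)))
    ... | no ¬r = refl ,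
          trans (parity-row (even (toℕ j)) (not (g j)))
                (trans (sym (not-involutive _)) (cong not (sym (¬-not ¬r))))

    freeMate-free : ∀ v → ¬ Horizontal (freeMate v)
    freeMate-free v with rightward? v
    ... | yes _ = freeLeft-free (proj₂ v)
    ... | no _ = freeRight-free (proj₂ v)

    freeMate-involutive : ∀ v → ¬ Horizontal v → freeMate (freeMate v) ≡ v
    freeMate-involutive v ¬h with toSum (rightward? v)
    ... | inj₁ r = begin
      freeMate (freeMate v)
        ≡⟨ cong freeMate (freeMate-rightward v r) ⟩
      freeMate (freeLeft (proj₂ v))
        ≡⟨ freeMate-leftward (freeLeft (proj₂ v)) (freeLeft-leftward (proj₂ v)) ⟩
      freeRight (proj₂ (freeLeft (proj₂ v)))
        ≡⟨ cong freeRight (col-freeLeft (proj₂ v)) ⟩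
      freeRight (proj₂ v)
        ≡⟨ sym (free-rightward v ¬h r) ⟩
      v ∎
    ... | inj₂ ¬r = begin
      freeMate (freeMate v)
        ≡⟨ cong freeMate (freeMate-leftward v ¬r) ⟩
      freeMate (freeRight (proj₂ v))
        ≡⟨ freeMate-rightward (freeRight (proj₂ v)) (freeRight-rightward (proj₂ v)) ⟩
      freeLeft (proj₂ v)
        ≡⟨ sym (free-leftward v ¬h ¬r) ⟩
      v ∎

    mixedMate-horizontal : ∀ v → Horizontal v → mixedMate v ≡ horizontal v
    mixedMate-horizontal v h with horizontal? v
    ... | yes _ = refl
    ... | no ¬h = ⊥-elim (¬h h)

    mixedMate-free : ∀ v → ¬ Horizontal v → mixedMate v ≡ freeMate v
    mixedMate-free v ¬h with horizontal? v
    ... | yes h = ⊥-elim (¬h h)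
    ... | no _ = refl

    mixedMatching : MatchingInvolution (T m c)
    mixedMatching = record
      { mate = mixedMate
      ; mate-involutive = involutive
      ; mate-irreflexive = irreflexive
      ; mate-adjacent = adjacent
      }
      where
        involutive : ∀ v → mixedMate (mixedMate v) ≡ v
        involutive v with horizontal? v
        ... | yes h = trans (mixedMate-horizontal (horizontal v) (horizontal-preserves-Horizontal v h))
                            (horizontal-involutive v)
        ... | no ¬h = trans (mixedMate-free (freeMate v) (freeMate-free v)) (freeMate-involutive v ¬h)
        irreflexive : ∀ v → mixedMate v ≢ v
        irreflexive v with horizontal? v
        ... | yes _ = horizontal-irreflexive v
        ... | no _ = vertical-irreflexive v (freeMate v) (freeMate-vertical v)
        adjacent : ∀ v → TAdj m c v (mixedMate v)
        adjacent v with horizontal? v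
        ... | yes _ = horizontal-adjacent v
        ... | no _ = vertical⇒adjacent v (freeMate v) (freeMate-vertical v)

  MatchingThrough : Vertex → Vertex → Vertex → Vertex → Set
  MatchingThrough a b a′ b′ = Σ[ σ ∈ MatchingInvolution (T m c) ] mate σ a ≡ b × mate σ a′ ≡ b′

  rows-distinct : ∀ {i k : Fin 4} {j : Fin m} → (i , j) ≢ (k , j) → k ≢ i
  rows-distinct {j = j} ne = ne ∘ cong (_, j) ∘ sym

  disjoint-rungs-xor : ∀ a b a′ b′ → Vertical a b → Vertical a′ b′ → proj₂ a′ ≡ proj₂ a →
    a ≢ a′ → a ≢ b′ → b ≢ a′ → b ≢ b′ →
    level (proj₁ a′) xor level (proj₁ b′) ≡ level (proj₁ a) xor level (proj₁ b)
  disjoint-rungs-xor (i , j) (i′ , .j) (k , .j) (k′ , .j) (refl , p) (refl , p′) refl a≢a′ a≢b′ b≢a′ b≢b′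
    with parity k Bool.≟ parity i
  ... | yes k∼i = begin
    level k xor level k′             ≡⟨ cong₂ _xor_ (level-opposite k∼i (rows-distinct a≢a′))
                                                   (level-opposite k′∼i′ (rows-distinct b≢b′)) ⟩
    not (level i) xor not (level i′) ≡⟨ xor-annihilates-not (level i) (level i′) ⟩
    level i xor level i′             ∎
    where
      k′∼i′ : parity k′ ≡ parity i′
      k′∼i′ = trans p′ (trans (cong not k∼i) (sym p))
  ... | no k≁i = begin
    level k xor level k′             ≡⟨ cong₂ _xor_ (level-opposite k∼i′ (rows-distinct b≢a′))
                                                   (level-opposite k′∼i (rows-distinct a≢b′)) ⟩
    not (level i′) xor not (level i) ≡⟨ xor-annihilates-not (level i′) (level i) ⟩
    level i′ xor level i             ≡⟨ xor-comm (level i′) (level i) ⟩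
    level i xor level i′             ∎
    where
      k∼i′ : parity k ≡ parity i′
      k∼i′ = trans (¬-not k≁i) (sym p)
      k′∼i : parity k′ ≡ parity i
      k′∼i = trans p′ (trans (cong not (¬-not k≁i)) (not-involutive (parity i)))

  verticalMate-pairs : ∀ s a b → Vertical a b → s (proj₂ a) ≡ level (proj₁ a) xor level (proj₁ b) →
    verticalMate s a ≡ b
  verticalMate-pairs s (i , j) (i′ , .j) (refl , p) e = cong (_, j) (begin
    row (not (parity i)) (level i xor s j)
      ≡⟨ cong₂ row (sym p) (cong (level i xor_) e) ⟩
    row (parity i′) (level i xor (level i xor level i′))
      ≡⟨ cong (row (parity i′)) (trans (sym (xor-assoc (level i) (level i) (level i′)))
                                       (cong (_xor level i′) (xor-same (level i)))) ⟩
    row (parity i′) (level i′)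
      ≡⟨ row-parity-level i′ ⟩
    i′ ∎)

  vertical-extension : ∀ a b a′ b′ → Vertical a b → Vertical a′ b′ →
    a ≢ a′ → a ≢ b′ → b ≢ a′ → b ≢ b′ → MatchingThrough a b a′ b′
  vertical-extension a b a′ b′ ab a′b′ a≢a′ a≢b′ b≢a′ b≢b′ =
    verticalMatching s , verticalMate-pairs s a b ab s-a , verticalMate-pairs s a′ b′ a′b′ s-a′
    where
      s : Fin m → Bool
      s j with j Fin.≟ proj₂ a
      ... | yes _ = level (proj₁ a) xor level (proj₁ b)
      ... | no _ = level (proj₁ a′) xor level (proj₁ b′)
      s-a : s (proj₂ a) ≡ level (proj₁ a) xor level (proj₁ b)
      s-a with proj₂ a Fin.≟ proj₂ a
      ... | yes _ = refl
      ... | no ne = ⊥-elim (ne refl)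
      s-a′ : s (proj₂ a′) ≡ level (proj₁ a′) xor level (proj₁ b′)
      s-a′ with proj₂ a′ Fin.≟ proj₂ a
      ... | yes same = sym (disjoint-rungs-xor a b a′ b′ ab a′b′ same a≢a′ a≢b′ b≢a′ b≢b′)
      ... | no _ = refl

  rightEnd-avoids : ∀ u z → z ≢ u → z ≢ horizontal u → rightEnd u ≢ z × right (rightEnd u) ≢ z
  rightEnd-avoids u z z≢u z≢hu with rightEnd-cases u
  ... | inj₁ (w≡u , rw≡hu) = (λ w≡z → z≢u (trans (sym w≡z) w≡u)) , (λ rw≡z → z≢hu (trans (sym rw≡z) rw≡hu))
  ... | inj₂ (w≡hu , rw≡u) = (λ w≡z → z≢hu (trans (sym w≡z) w≡hu)) , (λ rw≡z → z≢u (trans (sym rw≡z) rw≡u))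

  linkChoice : Fin m → Bool → Bool → Bool → Fin m → Bool
  linkChoice j₀ a b d k with k Fin.≟ j₀ | k Fin.≟ prev j₀
  ... | yes _ | _ = a
  ... | no _ | yes _ = b
  ... | no _ | no _ = d

  linkChoice-at : ∀ j₀ a b d → linkChoice j₀ a b d j₀ ≡ a
  linkChoice-at j₀ a b d with j₀ Fin.≟ j₀
  ... | yes _ = refl
  ... | no j₀≢j₀ = ⊥-elim (j₀≢j₀ refl)

  linkChoice-prev : ∀ j₀ a b d → linkChoice j₀ a b d (prev j₀) ≡ b
  linkChoice-prev j₀ a b d with prev j₀ Fin.≟ j₀ | prev j₀ Fin.≟ prev j₀
  ... | yes same | _ = ⊥-elim (prev-irreflexive j₀ same)
  ... | no _ | yes _ = refl
  ... | no _ | no prev≢prev = ⊥-elim (prev≢prev refl)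

  linkChoice-other : ∀ j₀ a b d k → k ≢ j₀ → k ≢ prev j₀ → linkChoice j₀ a b d k ≡ d
  linkChoice-other j₀ a b d k k≢j₀ k≢prev with k Fin.≟ j₀ | k Fin.≟ prev j₀
  ... | yes same | _ = ⊥-elim (k≢j₀ same)
  ... | no _ | yes same = ⊥-elim (k≢prev same)
  ... | no _ | no _ = refl

  free-pair : ∀ g x y → Rightward x → Vertical x y →
    ¬ Mixed.Horizontal g x → ¬ Mixed.Horizontal g y → Mixed.mixedMate g x ≡ y
  free-pair g x y rx xy x-free y-free = begin
    mixedMate x        ≡⟨ mixedMate-free x x-free ⟩
    freeMate x         ≡⟨ freeMate-rightward x rx ⟩
    freeLeft (proj₂ x) ≡⟨ cong freeLeft (sym (proj₁ xy)) ⟩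
    freeLeft (proj₂ y) ≡⟨ sym (free-leftward y y-free (vertical-leftward x y xy rx)) ⟩
    y                  ∎
    where open Mixed g

  link-choice : ∀ x y u → Rightward x → Vertical x y →
    x ≢ u → x ≢ horizontal u → y ≢ u → y ≢ horizontal u →
    Σ[ g ∈ (Fin m → Bool) ] ¬ Mixed.Horizontal g x × ¬ Mixed.Horizontal g y × Mixed.Horizontal g u
  link-choice x y u rx xy x≢u x≢hu y≢u y≢hu = g , x-free , y-free , u-horizontal
    where
      j₀ : Fin m
      j₀ = proj₂ x
      w : Vertex
      w = rightEnd u
      g : Fin m → Bool
      g = linkChoice j₀ (not (level (proj₁ x))) (not (level (proj₁ (left y)))) (level (proj₁ w))
      open Mixed g

      ¬ry : ¬ Rightward y
      ¬ry = vertical-leftward x y xy rx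
      col-left-y : proj₂ (left y) ≡ prev j₀
      col-left-y = trans (col-left (proj₁ y) (proj₂ y)) (cong prev (proj₁ xy))

      x-free : ¬ Horizontal x
      x-free h = not-¬ refl (trans (subst Chosen (rightEnd-rightward x rx) h) (linkChoice-at j₀ _ _ _))

      y-free : ¬ Horizontal y
      y-free h = not-¬ refl (trans (subst Chosen (rightEnd-leftward y ¬ry) h)
                                   (trans (cong g col-left-y) (linkChoice-prev j₀ _ _ _)))

      u-horizontal : Horizontal u
      u-horizontal with toSum (proj₂ w Fin.≟ j₀) | toSum (proj₂ w Fin.≟ prev j₀)
      ... | inj₁ same | _ =
        trans (rightward-level-opposite w x same (rightward-rightEnd u) rx (proj₁ (rightEnd-avoids u x x≢u x≢hu)))
              (sym (trans (cong g same) (linkChoice-at j₀ _ _ _)))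
      ... | inj₂ _ | inj₁ same =
        trans (rightward-level-opposite w (left y) (trans same (sym col-left-y))
                 (rightward-rightEnd u) (left-rightward y ¬ry) w≢left-y)
              (sym (trans (cong g same) (linkChoice-prev j₀ _ _ _)))
        where
          w≢left-y : w ≢ left y
          w≢left-y w≡ly = proj₂ (rightEnd-avoids u y y≢u y≢hu) (trans (cong right w≡ly) (right-left y ¬ry))
      ... | inj₂ w≢j₀ | inj₂ w≢prev = sym (linkChoice-other j₀ _ _ _ (proj₂ w) w≢j₀ w≢prev)

  mixed-extension : ∀ x y u → Rightward x → Vertical x y →
    x ≢ u → x ≢ horizontal u → y ≢ u → y ≢ horizontal u → MatchingThrough x y u (horizontal u)
  mixed-extension x y u rx xy x≢u x≢hu y≢u y≢hu with link-choice x y u rx xy x≢u x≢hu y≢u y≢hu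
  ... | g , x-free , y-free , u-horizontal =
    Mixed.mixedMatching g , free-pair g x y rx xy x-free y-free , Mixed.mixedMate-horizontal g u u-horizontal

  vertical-horizontal-extension : ∀ a b u → Vertical a b →
    a ≢ u → a ≢ horizontal u → b ≢ u → b ≢ horizontal u → MatchingThrough a b u (horizontal u)
  vertical-horizontal-extension a b u ab a≢u a≢hu b≢u b≢hu with toSum (rightward? a)
  ... | inj₁ ra = mixed-extension a b u ra ab a≢u a≢hu b≢u b≢hu
  ... | inj₂ ¬ra with mixed-extension b a u (vertical-rightward a b ab ¬ra) (vertical-sym a b ab) b≢u b≢hu a≢u a≢hu
  ... | σ , σb≡a , σu = σ , trans (cong (mate σ) (sym σb≡a)) (mate-involutive σ b) , σu

  disjoint-edges-extension : ∀ a b a′ b′ → TAdj m c a b → TAdj m c a′ b′ →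
    a ≢ a′ → a ≢ b′ → b ≢ a′ → b ≢ b′ → MatchingThrough a b a′ b′
  disjoint-edges-extension a b a′ b′ ab a′b′ a≢a′ a≢b′ b≢a′ b≢b′
    with adjacent-cases a b ab | adjacent-cases a′ b′ a′b′
  ... | inj₂ refl | inj₂ refl = horizontalMatching , refl , refl
  ... | inj₁ vab | inj₁ va′b′ = vertical-extension a b a′ b′ vab va′b′ a≢a′ a≢b′ b≢a′ b≢b′
  ... | inj₁ vab | inj₂ refl = vertical-horizontal-extension a b a′ vab a≢a′ a≢b′ b≢a′ b≢b′
  ... | inj₂ refl | inj₁ va′b′
    with vertical-horizontal-extension a′ b′ a va′b′ (≢-sym a≢a′) (≢-sym b≢a′) (≢-sym a≢b′) (≢-sym b≢b′)
  ... | σ , σa′ , σa = σ , σa , σa′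

mainTheorem9 : (m : ℕ) → 2 ≤ m → (c : MChoice) → Extendable (T m c) 2
mainTheorem9 (suc zero) (s≤s ()) c
mainTheorem9 (suc (suc n)) _ c = enough-vertices , rungs , extend
  where
    open Layout n c

    enough-vertices : 2 * 2 + 2 ≤ 4 * m
    enough-vertices = ℕ.≤-trans (ℕ.m≤m+n 6 2) (ℕ.*-monoʳ-≤ 4 (s≤s (s≤s z≤n)))

    rungs : Σ[ es ∈ List (Vertex × Vertex) ] IsMatching (T m c) es × length es ≡ 2
    rungs = ((0F , zero) , (1F , zero)) ∷ ((2F , zero) , (3F , zero)) ∷ [] ,
            ( vertical-adjacent 0F 1F zero refl ∷ vertical-adjacent 2F 3F zero refl ∷ []
            , ((λ ()) ∷ (λ ()) ∷ (λ ()) ∷ []) ∷ ((λ ()) ∷ (λ ()) ∷ []) ∷ ((λ ()) ∷ []) ∷ [] ∷ [] ) ,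
            refl

    extend : ∀ es → IsMatching (T m c) es → length es ≡ 2 →
      Σ[ ps ∈ List (Vertex × Vertex) ] IsPerfectMatching (T m c) ps × ContainedIn (T m c) es ps
    extend ((a , b) ∷ (a′ , b′) ∷ []) ((ab ∷ a′b′ ∷ []) , ((_ ∷ a≢a′ ∷ a≢b′ ∷ []) ∷ (b≢a′ ∷ b≢b′ ∷ []) ∷ _)) refl
      with disjoint-edges-extension a b a′ b′ ab a′b′ a≢a′ a≢b′ b≢a′ b≢b′
    ... | σ , σa , σa′ = perfectMatchingOf (T m c) σ , perfectMatchingOf-isPerfect (T m c) σ ,
                         perfectMatchingOf-contains (T m c) σ σa ∷ perfectMatchingOf-contains (T m c) σ σa′ ∷ []
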